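{- Let $d$ be a positive integer, let $S=\{v_1,\ldots,v_n\}$ be a finite set of axis-aligned hypercubes in $\mathbb{R}^d$, and let $G$ be the intersection graph of $S$. For any set $Y\subseteq\{1,\ldots,n\}$, there exists a set $\{u_1,\ldots,u_n\}$ of axis-aligned hypercubes in $\mathbb{R}^{d+1}$ whose intersection graph is isomorphic to $G$ via the isomorphism mapping $u_i$ to $v_i$ for each $i$, such that \begin{itemize} \item for $1\le i<j\le n$, if $v_i$ and $v_j$ have disjoint interiors, then $u_i$ and $u_j$ have disjoint interiors, and \item for $i\in Y$ and $j\in\{1,\ldots,n\}\setminus Y$, the hypercubes $u_i$ and $u_j$ have disjoint interiors. \end{itemize}
   Context: The intersection graph of a finite set $S$ of objects has vertex set $S$, with $u\neq v$ adjacent iff $u\cap v\neq\emptyset$. An axis-aligned hypercube is a product of $d$ compact intervals of equal positive length. -}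

module Defs where

open import Data.Nat using (ℕ)
open import Data.Fin using (Fin)
open import Data.Product using (Σ; ∃; _×_)
open import Data.Sum using (_⊎_)
open import Data.Empty using (⊥)
open import Relation.Nullary using (¬_)
open import Relation.Binary.PropositionalEquality using (_≡_)

-- The real numbers, axiomatised as a complete ordered field
-- (unique up to isomorphism, classically).
record RealField : Set₁ where
  infixl 6 _+_
  infixl 7 _*_
  infix 4 _<_ _≤_
  field
    Carrier : Set
    0# 1#   : Carrier
    _+_ _*_ : Carrier → Carrier → Carrier
    -_      : Carrier → Carrier
    _⁻¹     : (x : Carrier) → ¬ (x ≡ 0#) → Carrier
    _<_     : Carrier → Carrier → Set
    +-assoc    : ∀ x y z → (x + y) + z ≡ x + (y + z)
    +-comm     : ∀ x y → x + y ≡ y + x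
    +-identity : ∀ x → x + 0# ≡ x
    +-inverse  : ∀ x → x + (- x) ≡ 0#
    *-assoc    : ∀ x y z → (x * y) * z ≡ x * (y * z)
    *-comm     : ∀ x y → x * y ≡ y * x
    *-identity : ∀ x → x * 1# ≡ x
    *-inverse  : ∀ x (p : ¬ (x ≡ 0#)) → x * (x ⁻¹) p ≡ 1#
    distrib    : ∀ x y z → x * (y + z) ≡ x * y + x * z
    0≢1        : ¬ (0# ≡ 1#)
    <-irrefl   : ∀ x → ¬ (x < x)
    <-trans    : ∀ {x y z} → x < y → y < z → x < z
    <-trichotomy : ∀ x y → x < y ⊎ x ≡ y ⊎ y < x
    +-mono-<   : ∀ {x y} z → x < y → x + z < y + z
    *-pos      : ∀ {x y} → 0# < x → 0# < y → 0# < x * y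

  _≤_ : Carrier → Carrier → Set
  x ≤ y = x < y ⊎ x ≡ y

  IsUpperBound : (Carrier → Set) → Carrier → Set
  IsUpperBound P b = ∀ x → P x → x ≤ b

  field
    complete : (P : Carrier → Set) → ∃ P → ∃ (IsUpperBound P) →
               Σ Carrier (λ s → IsUpperBound P s × (∀ b → IsUpperBound P b → s ≤ b))

module _ (ℝ : RealField) where
  open RealField ℝ

  Point : ℕ → Set
  Point d = Fin d → Carrier

  record Hypercube (d : ℕ) : Set where
    constructor cube
    field
      corner   : Point d
      side     : Carrier
      side-pos : 0# < side

  open Hypercube

  _∈C_ : ∀ {d} → Point d → Hypercube d → Set
  x ∈C c = ∀ k → (corner c k ≤ x k) × (x k ≤ corner c k + side c)

  _∈Int_ : ∀ {d} → Point d → Hypercube d → Set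
  x ∈Int c = ∀ k → (corner c k < x k) × (x k < corner c k + side c)

  Intersect : ∀ {d} → Hypercube d → Hypercube d → Set
  Intersect u v = ∃ λ x → x ∈C u × x ∈C v

  DisjointInteriors : ∀ {d} → Hypercube d → Hypercube d → Set
  DisjointInteriors u v = ¬ (∃ λ x → x ∈Int u × x ∈Int v)

  SameSet : ∀ {d} → Hypercube d → Hypercube d → Set
  SameSet u v = ∀ x → (x ∈C u → x ∈C v) × (x ∈C v → x ∈C u)

module Submission where

open import Defs
open import Data.Nat using (ℕ; suc; _≤_)
open import Data.Fin using (Fin; zero; suc)
open import Data.Fin.Subset using (Subset; _∈_; _∉_)
open import Data.Product using (Σ; _×_; _,_; proj₁; proj₂)
open import Relation.Nullary using (¬_)
open import Relation.Binary.PropositionalEquality using (_≡_; refl; sym; trans; subst; subst₂)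
open import Function.Bundles using (_⇔_; mk⇔)

open import Data.Bool using (Bool; true; false)
open import Data.Bool.Properties using (¬-not)
open import Data.Sum using (inj₁; inj₂)
open import Data.Vec using (lookup)
open import Data.Vec.Properties using ([]=⇒lookup; lookup⇒[]=)
open import Data.Vec.Functional using (_∷_; tail)
open import Function using (_∘_)

-- Prepend a new first coordinate x₀, extruding a cube of side s over x₀ ∈ [−s, 0]
-- if its index lies in Y and over x₀ ∈ [0, s] otherwise. Every extruded cube meets
-- the hyperplane x₀ = 0 in a copy of the original, so intersecting pairs still
-- intersect; projecting x₀ away shows that no new intersections, overlaps of
-- interiors or coincidences arise; and the interiors of the two groups lie in the
-- opposite open half-spaces x₀ < 0 and x₀ > 0.

module _ (ℝ : RealField) where
  open RealField ℝ renaming (_≤_ to _≤ᵣ_)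
  open Hypercube

  +-identityˡ : ∀ x → 0# + x ≡ x
  +-identityˡ x = trans (+-comm 0# x) (+-identity x)

  -x+x≡0 : ∀ x → - x + x ≡ 0#
  -x+x≡0 x = trans (+-comm (- x) x) (+-inverse x)

  neg-<0 : ∀ {x} → 0# < x → - x < 0#
  neg-<0 {x} 0<x = subst₂ _<_ (+-identityˡ (- x)) (+-inverse x) (+-mono-< (- x) 0<x)

  extrusionBase : Bool → Carrier → Carrier
  extrusionBase true  s = - s
  extrusionBase false s = 0#

  extrusionBase≤0 : ∀ b {s} → 0# < s → extrusionBase b s ≤ᵣ 0#
  extrusionBase≤0 true  0<s = inj₁ (neg-<0 0<s)
  extrusionBase≤0 false 0<s = inj₂ refl

  0≤extrusionBase+s : ∀ b {s} → 0# < s → 0# ≤ᵣ extrusionBase b s + s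
  0≤extrusionBase+s true  {s} 0<s = inj₂ (sym (-x+x≡0 s))
  0≤extrusionBase+s false {s} 0<s = inj₁ (subst (0# <_) (sym (+-identityˡ s)) 0<s)

  extrude : ∀ {d} → Bool → Hypercube ℝ d → Hypercube ℝ (suc d)
  extrude b c = cube (extrusionBase b (side c) ∷ corner c) (side c) (side-pos c)

  ∈C⇒0∷-∈C-extrude : ∀ {d} b (c : Hypercube ℝ d) {x} →
                     _∈C_ ℝ x c → _∈C_ ℝ (0# ∷ x) (extrude b c)
  ∈C⇒0∷-∈C-extrude b c x∈c zero    = extrusionBase≤0 b (side-pos c) , 0≤extrusionBase+s b (side-pos c)
  ∈C⇒0∷-∈C-extrude b c x∈c (suc k) = x∈c k

  ∈C-extrude⇒tail-∈C : ∀ {d} b (c : Hypercube ℝ d) {x} →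
                       _∈C_ ℝ x (extrude b c) → _∈C_ ℝ (tail x) c
  ∈C-extrude⇒tail-∈C b c x∈c k = x∈c (suc k)

  ∈Int-extrude⇒tail-∈Int : ∀ {d} b (c : Hypercube ℝ d) {x} →
                           _∈Int_ ℝ x (extrude b c) → _∈Int_ ℝ (tail x) c
  ∈Int-extrude⇒tail-∈Int b c x∈c k = x∈c (suc k)

  Intersect-extrude⇔ : ∀ {d} b b′ (c c′ : Hypercube ℝ d) →
                       Intersect ℝ (extrude b c) (extrude b′ c′) ⇔ Intersect ℝ c c′
  Intersect-extrude⇔ b b′ c c′ = mk⇔
    (λ (x , x∈c , x∈c′) → tail x , ∈C-extrude⇒tail-∈C b c x∈c , ∈C-extrude⇒tail-∈C b′ c′ x∈c′)
    (λ (x , x∈c , x∈c′) → 0# ∷ x , ∈C⇒0∷-∈C-extrude b c x∈c , ∈C⇒0∷-∈C-extrude b′ c′ x∈c′)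

  DisjointInteriors-extrude : ∀ {d} b b′ (c c′ : Hypercube ℝ d) →
                              DisjointInteriors ℝ c c′ →
                              DisjointInteriors ℝ (extrude b c) (extrude b′ c′)
  DisjointInteriors-extrude b b′ c c′ disjoint (x , x∈c , x∈c′) =
    disjoint (tail x , ∈Int-extrude⇒tail-∈Int b c x∈c , ∈Int-extrude⇒tail-∈Int b′ c′ x∈c′)

  SameSet-extrude⇒SameSet : ∀ {d} b b′ (c c′ : Hypercube ℝ d) →
                            SameSet ℝ (extrude b c) (extrude b′ c′) → SameSet ℝ c c′
  SameSet-extrude⇒SameSet b b′ c c′ same x =
    (λ x∈c  → ∈C-extrude⇒tail-∈C b′ c′ (proj₁ (same (0# ∷ x)) (∈C⇒0∷-∈C-extrude b c x∈c))) ,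
    (λ x∈c′ → ∈C-extrude⇒tail-∈C b c (proj₂ (same (0# ∷ x)) (∈C⇒0∷-∈C-extrude b′ c′ x∈c′)))

  DisjointInteriors-extrude-true-false : ∀ {d} (c c′ : Hypercube ℝ d) →
                                         DisjointInteriors ℝ (extrude true c) (extrude false c′)
  DisjointInteriors-extrude-true-false c c′ (x , x∈c , x∈c′) =
    <-irrefl (x zero) (<-trans x₀<0 (proj₁ (x∈c′ zero)))
    where
    x₀<0 : x zero < 0#
    x₀<0 = subst (x zero <_) (-x+x≡0 (side c)) (proj₂ (x∈c zero))

lemma14 : (ℝ : RealField) (d n : ℕ) → 1 ≤ d
    → (v : Fin n → Hypercube ℝ d)
    → (∀ i j → ¬ (i ≡ j) → ¬ SameSet ℝ (v i) (v j))
    → (Y : Subset n)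
    → Σ (Fin n → Hypercube ℝ (suc d)) (λ u →
        (∀ i j → ¬ (i ≡ j) → ¬ SameSet ℝ (u i) (u j))
        × (∀ i j → ¬ (i ≡ j) → (Intersect ℝ (u i) (u j) ⇔ Intersect ℝ (v i) (v j)))
        × (∀ i j → ¬ (i ≡ j) → DisjointInteriors ℝ (v i) (v j) → DisjointInteriors ℝ (u i) (u j))
        × (∀ i j → i ∈ Y → j ∉ Y → DisjointInteriors ℝ (u i) (u j)))
lemma14 ℝ d n _ v v-distinct Y = u , u-distinct , u-intersect , u-disjoint , u-separated
  where
  u : Fin n → Hypercube ℝ (suc d)
  u i = extrude ℝ (lookup Y i) (v i)

  u-distinct : ∀ i j → ¬ (i ≡ j) → ¬ SameSet ℝ (u i) (u j)
  u-distinct i j i≢j = v-distinct i j i≢j ∘ SameSet-extrude⇒SameSet ℝ (lookup Y i) (lookup Y j) (v i) (v j)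

  u-intersect : ∀ i j → ¬ (i ≡ j) → (Intersect ℝ (u i) (u j) ⇔ Intersect ℝ (v i) (v j))
  u-intersect i j _ = Intersect-extrude⇔ ℝ (lookup Y i) (lookup Y j) (v i) (v j)

  u-disjoint : ∀ i j → ¬ (i ≡ j) → DisjointInteriors ℝ (v i) (v j) → DisjointInteriors ℝ (u i) (u j)
  u-disjoint i j _ = DisjointInteriors-extrude ℝ (lookup Y i) (lookup Y j) (v i) (v j)

  u-separated : ∀ i j → i ∈ Y → j ∉ Y → DisjointInteriors ℝ (u i) (u j)
  u-separated i j i∈Y j∉Y =
    subst₂ (λ b b′ → DisjointInteriors ℝ (extrude ℝ b (v i)) (extrude ℝ b′ (v j)))
      (sym ([]=⇒lookup i∈Y)) (sym (¬-not (j∉Y ∘ lookup⇒[]= j Y)))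
      (DisjointInteriors-extrude-true-false ℝ (v i) (v j))
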